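{- Fix integers $r,k$ with $3 \le r \le k$, and let $e$ be an edge of a graph $G$ such that $\chi(G)=k+1$ and $\chi(G-e)=k$. Let $x$ be an endpoint of $e$. Then $G-e$ contains at least $\frac{1}{2}\prod_{i=1}^{r-1}(k-i)$ cycles of length $0 \bmod r$ that contain the vertex $x$.
   Context: $\chi$ denotes chromatic number; $G-e$ is the graph obtained by deleting the edge $e$. Cycles are counted as subgraphs. -}

module Defs where

open import Data.Nat using (ℕ; zero; suc; _*_; _∸_; _≤_)
open import Data.Fin using (Fin; toℕ; _≟_)
open import Data.Bool using (Bool; true; false; T; _∧_; _∨_; not)
open import Data.Bool.Properties using (∧-zeroʳ; ∨-comm)
open import Data.Product using (Σ; ∃; _×_; _,_)
open import Data.Sum using (_⊎_)
open import Relation.Nullary using (¬_)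
open import Relation.Nullary.Decidable using (⌊_⌋)
open import Relation.Binary.PropositionalEquality using (_≡_; _≢_; cong₂)
open import Function.Definitions using (Injective)

record Graph (n : ℕ) : Set where
  field
    adj    : Fin n → Fin n → Bool
    sym    : ∀ u v → adj u v ≡ adj v u
    irrefl : ∀ u → adj u u ≡ false

open Graph public

Adj : ∀ {n} → Graph n → Fin n → Fin n → Set
Adj G u v = T (adj G u v)

isEdge : ∀ {n} → Fin n → Fin n → Fin n → Fin n → Bool
isEdge a b u v = (⌊ u ≟ a ⌋ ∧ ⌊ v ≟ b ⌋) ∨ (⌊ u ≟ b ⌋ ∧ ⌊ v ≟ a ⌋)

boolLemma : ∀ w x y z → (w ∧ x) ∨ (y ∧ z) ≡ (z ∧ y) ∨ (x ∧ w)
boolLemma true  true  true  true  = _≡_.refl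
boolLemma true  true  true  false = _≡_.refl
boolLemma true  true  false true  = _≡_.refl
boolLemma true  true  false false = _≡_.refl
boolLemma true  false true  true  = _≡_.refl
boolLemma true  false true  false = _≡_.refl
boolLemma true  false false true  = _≡_.refl
boolLemma true  false false false = _≡_.refl
boolLemma false true  true  true  = _≡_.refl
boolLemma false true  true  false = _≡_.refl
boolLemma false true  false true  = _≡_.refl
boolLemma false true  false false = _≡_.refl
boolLemma false false true  true  = _≡_.refl
boolLemma false false true  false = _≡_.refl
boolLemma false false false true  = _≡_.refl
boolLemma false false false false = _≡_.refl

isEdge-sym : ∀ {n} (a b u v : Fin n) → isEdge a b u v ≡ isEdge a b v u
isEdge-sym a b u v = boolLemma ⌊ u ≟ a ⌋ ⌊ v ≟ b ⌋ ⌊ u ≟ b ⌋ ⌊ v ≟ a ⌋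

deleteEdge : ∀ {n} → Graph n → Fin n → Fin n → Graph n
deleteEdge G a b = record
  { adj    = λ u v → adj G u v ∧ not (isEdge a b u v)
  ; sym    = λ u v → cong₂ (λ p q → p ∧ not q) (Graph.sym G u v) (isEdge-sym a b u v)
  ; irrefl = λ u → helper (adj G u u) (Graph.irrefl G u)
  }
  where
  helper : ∀ x {y} → x ≡ false → x ∧ y ≡ false
  helper .false _≡_.refl = _≡_.refl

Colourable : ∀ {n} → Graph n → ℕ → Set
Colourable {n} G m = Σ (Fin n → Fin m) λ c → ∀ u v → Adj G u v → c u ≢ c v

ChromaticNumber : ∀ {n} → Graph n → ℕ → Set
ChromaticNumber G m = Colourable G m × (∀ j → j Data.Nat.< m → ¬ Colourable G j)
  where import Data.Nat

Consecutive : ∀ {L} → Fin L → Fin L → Set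
Consecutive {L} i j = suc (toℕ i) ≡ toℕ j ⊎ (suc (toℕ i) ≡ L × toℕ j ≡ 0)

record Cycle {n} (G : Graph n) : Set where
  field
    len      : ℕ
    len≥3    : 3 ≤ len
    vert     : Fin len → Fin n
    distinct : Injective _≡_ _≡_ vert
    adjacent : ∀ i j → Consecutive i j → Adj G (vert i) (vert j)

open Cycle public

CycleEdge : ∀ {n} {G : Graph n} → Cycle G → Fin n → Fin n → Set
CycleEdge C u v = ∃ λ i → ∃ λ j → Consecutive {len C} i j ×
  ((vert C i ≡ u × vert C j ≡ v) ⊎ (vert C i ≡ v × vert C j ≡ u))

-- two cycles are the same subgraph iff they have the same edge set
SameCycle : ∀ {n} {G : Graph n} → Cycle G → Cycle G → Set
SameCycle C D = ∀ u v → (CycleEdge C u v → CycleEdge D u v) × (CycleEdge D u v → CycleEdge C u v)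

ContainsVertex : ∀ {n} {G : Graph n} → Cycle G → Fin n → Set
ContainsVertex C x = ∃ λ i → vert C i ≡ x

prodMinus : ℕ → ℕ → ℕ
prodMinus k zero    = 1
prodMinus k (suc m) = prodMinus k m * (k ∸ suc m)

-- Colour G − ab properly with k colours; then a and b get the same colour c₀, or G would be
-- k-colourable. Fix distinct colours c₀, s₁, …, s_{r−1}, let σ be the cyclic permutation
-- c₀ ↦ s₁ ↦ ⋯ ↦ s_{r−1} ↦ c₀ (fixing all other colours), and call uw an arc if it is an edge of
-- G − ab with c w = σ (c u). If the vertices reachable from a along arcs missed b, recolouring
-- them by σ ∘ c would properly colour G − ab with c a ≠ c b, hence G, with k colours. So there
-- are arc walks a → b → a, and their concatenation through x contains a cycle through x whose
-- colours run periodically through c₀, s₁, …, s_{r−1}: its length is divisible by r. There are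
-- (k−1)⋯(k−r+1) such colour sequences, and a cycle arises from at most two of them, namely
-- from its colours read in either direction.
module Submission where

open import Defs
open import Data.Nat using (ℕ; suc; _*_; _∸_; _≤_)
open import Data.Nat.Divisibility using (_∣_)
open import Data.Fin using (Fin)
open import Data.List using (List; length)
open import Data.List.Relation.Unary.All using (All)
open import Data.List.Relation.Unary.AllPairs using (AllPairs)
open import Data.Product using (∃; _×_)
open import Data.Sum using (_⊎_)
open import Relation.Nullary using (¬_)
open import Relation.Binary.PropositionalEquality using (_≡_)

open import Data.Nat using (zero; pred; _+_; _<_; z≤n; s≤s; s≤s⁻¹; _≤?_; _<?_; NonZero; >-nonZero; >-nonZero⁻¹)
open import Data.Nat.Properties
  using ( ≤-refl; ≤-reflexive; ≤-trans; <-trans; <⇒≤; <⇒≢; <⇒≱; ≤⇒≯; <-cmp; n<1+n; m≤m+n; +-comm; +-suc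
        ; +-mono-≤; +-monoʳ-≤; +-monoˡ-<; *-monoˡ-≤; *-suc; suc-pred; pred-mono-≤; pred[m∸n]≡m∸[1+n]
        ; m∸n≤m; m∸n+n≡m; m+[n∸m]≡n; m+n≤o⇒m≤o∸n; ∸-monoʳ-<; m<n⇒0<n∸m; +-∸-assoc; module ≤-Reasoning)
open import Data.Nat.DivMod using (_%_; _mod_; %-distribˡ-+; m%n%n≡m%n; [m+n]%n≡m%n; m<n⇒m%n≡m; m%n<n; n%n≡0)
open import Data.Nat.Divisibility using (m%n≡0⇒n∣m; ∣⇒≤)
open import Data.Nat.Induction using (<-wellFounded)
open import Data.Bool using (T; true; false; not; _∧_)
open import Data.Bool.Properties using (T-∧; T-∨; T?)
open import Data.Unit using (tt)
open import Data.Fin using (toℕ; fromℕ<; _≟_)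
import Data.Fin as Fin
open import Data.Fin.Properties using (any?; toℕ<n; toℕ-fromℕ<; fromℕ<-cong; toℕ-injective)
open import Data.Fin.Subset using (Subset; _∈_; _∉_; ⁅_⁆; _∪_; ∣_∣)
open import Data.Fin.Subset.Properties using (_∈?_; x∈⁅x⁆; x∈⁅y⁆⇒x≡y; p⊆p∪q; x∈p∪q⁻; x∈p∪q⁺; p⊂q⇒∣p∣<∣q∣; ∣p∣≤n)
open import Data.Vec using (Vec; []; _∷_; lookup; tabulate)
open import Data.Vec.Properties using (≡-dec; ∷-injectiveˡ; ∷-injectiveʳ; lookup∘tabulate)
import Data.Vec.Relation.Unary.All as VecAll
import Data.Vec.Relation.Unary.Unique.Propositional as Vec
open import Data.Vec.Relation.Unary.Unique.Propositional.Properties using (lookup-injective)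
open import Data.Vec.Relation.Binary.Pointwise.Extensional using (ext; Pointwise-≡⇒≡)
open import Data.List using ([]; _∷_; filter; concatMap; map; allFin; [_])
open import Data.List.Properties using (length-filter; filter-all; length-map; length-++; length-tabulate)
import Data.List.Membership.Propositional as List
open import Data.List.Membership.Propositional.Properties using (∈-filter⁻; ∈-map⁻)
open import Data.List.Relation.Unary.All as All using ([]; _∷_)
import Data.List.Relation.Unary.All.Properties as Allₚ
open import Data.List.Relation.Unary.AllPairs as AllPairs using ([]; _∷_)
import Data.List.Relation.Unary.AllPairs.Properties as AllPairsₚ
open import Data.List.Relation.Unary.Unique.Propositional using (Unique)
import Data.List.Relation.Unary.Unique.Propositional.Properties as Uniqueₚ
open import Data.List.Relation.Binary.Subset.Propositional using (_⊆_)
open import Data.List.Relation.Binary.Subset.Propositional.Properties using (⊆-refl; ⊆-trans; filter-⊆; ∷⁺ʳ)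
open import Data.List.Relation.Binary.Disjoint.Propositional using (Disjoint)
open import Data.Product using (Σ; ∃₂; _,_; proj₁; proj₂)
open import Data.Sum using (inj₁; inj₂; [_,_]′)
import Data.Sum as Sum
open import Function.Bundles using (Equivalence)
open import Function.Definitions using (Injective)
open import Induction.WellFounded using (Acc; acc)
open import Relation.Binary using (tri<; tri≈; tri>)
open import Relation.Binary.Definitions using (Decidable; DecidableEquality)
open import Relation.Binary.Construct.Closure.ReflexiveTransitive using (Star; ε; _◅_; _◅◅_)
open import Relation.Nullary using (¬?; yes; no; contradiction)
open import Relation.Nullary.Decidable using (⌊_⌋; toWitness; _×-dec_; decidable-stable)
open import Relation.Binary.PropositionalEquality as ≡
  using (_≢_; refl; cong; trans; subst; subst₂; module ≡-Reasoning)

module _ {A : Set} (_≟_ : DecidableEquality A) where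

  without : A → List A → List A
  without b = filter (λ a → ¬? (a ≟ b))

  length-without : ∀ b {xs} → Unique xs → length xs ≤ suc (length (without b xs))
  length-without b {[]}     []          = z≤n
  length-without b {x ∷ xs} (x∉xs ∷ xs!) with x ≟ b
  ... | yes refl = s≤s (≤-reflexive (≡.sym (cong length (filter-all (λ a → ¬? (a ≟ x)) xs≢x))))
    where xs≢x = All.map (λ x≢a a≡x → x≢a (≡.sym a≡x)) x∉xs
  ... | no  _    = s≤s (length-without b xs!)

  -- Each kept element discards at most one later element, namely its image under f.
  halving : (f : A → A) (xs : List A) → Unique xs →
    ∃ λ ys → ys ⊆ xs × AllPairs (λ s t → s ≢ t × t ≢ f s) ys × length xs ≤ 2 * length ys
  halving f xs xs! = go (length xs) xs ≤-refl xs!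
    where
    go : ∀ fuel xs → length xs ≤ fuel → Unique xs →
      ∃ λ ys → ys ⊆ xs × AllPairs (λ s t → s ≢ t × t ≢ f s) ys × length xs ≤ 2 * length ys
    go _ [] _ [] = [] , ⊆-refl , [] , z≤n
    go (suc fuel) (x ∷ xs) (s≤s xs≤fuel) (x∉xs ∷ xs!)
      with ys , ys⊆ , ys! , xs≤2ys ← go fuel (without (f x) xs)
             (≤-trans (length-filter _ xs) xs≤fuel) (Uniqueₚ.filter⁺ _ xs!) =
      x ∷ ys ,
      ∷⁺ʳ x (⊆-trans ys⊆ (filter-⊆ _ xs)) ,
      Allₚ.anti-mono ys⊆ (All.zip (Allₚ.filter⁺ _ x∉xs , Allₚ.all-filter _ xs)) ∷ ys! ,
      (begin
        suc (length xs)                        ≤⟨ s≤s (length-without (f x) xs!) ⟩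
        suc (suc (length (without (f x) xs)))  ≤⟨ s≤s (s≤s xs≤2ys) ⟩
        2 + 2 * length ys                      ≡⟨ *-suc 2 (length ys) ⟨
        2 * suc (length ys)                    ∎)
      where open ≤-Reasoning

length-concatMap-≥ : ∀ {A B : Set} (f : A → List B) {b} → (∀ x → b ≤ length (f x)) →
  ∀ xs → length xs * b ≤ length (concatMap f xs)
length-concatMap-≥ f f≥b []       = z≤n
length-concatMap-≥ f f≥b (x ∷ xs) =
  ≤-trans (+-mono-≤ (f≥b x) (length-concatMap-≥ f f≥b xs)) (≤-reflexive (≡.sym (length-++ (f x))))

module _ {A B : Set} {P : A → Set} (f : ∀ {x} → P x → B) where

  length-reduce : ∀ {xs} (pxs : All P xs) → length (All.reduce f pxs) ≡ length xs
  length-reduce []         = refl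
  length-reduce (px ∷ pxs) = cong suc (length-reduce pxs)

  reduce⁺ : ∀ {Q : B → Set} → (∀ {x} (px : P x) → Q (f px)) →
    ∀ {xs} (pxs : All P xs) → All Q (All.reduce f pxs)
  reduce⁺ q []         = []
  reduce⁺ q (px ∷ pxs) = q px ∷ reduce⁺ q pxs

  reduce-pairs⁺ : ∀ {R : A → A → Set} {S : B → B → Set} →
    (∀ {x y} (px : P x) (py : P y) → R x y → S (f px) (f py)) →
    ∀ {xs} (pxs : All P xs) → AllPairs R xs → AllPairs S (All.reduce f pxs)
  reduce-pairs⁺ s []         []         = []
  reduce-pairs⁺ {R = R} {S} s (px ∷ pxs) (rs ∷ rss) = heads pxs rs ∷ reduce-pairs⁺ s pxs rss
    where
    heads : ∀ {ys} (pys : All P ys) → All (R _) ys → All (S (f px)) (All.reduce f pys)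
    heads []         []       = []
    heads (py ∷ pys) (r ∷ rs) = s px py r ∷ heads pys rs

module _ {k : ℕ} where

  avoiding : ∀ {m} → Vec (Fin k) m → List (Fin k)
  avoiding []      = allFin k
  avoiding (b ∷ w) = without _≟_ b (avoiding w)

  avoiding-unique : ∀ {m} (w : Vec (Fin k) m) → Unique (avoiding w)
  avoiding-unique []      = Uniqueₚ.allFin⁺ k
  avoiding-unique (b ∷ w) = Uniqueₚ.filter⁺ _ (avoiding-unique w)

  ∈-avoiding⁻ : ∀ {m a} (w : Vec (Fin k) m) → a List.∈ avoiding w → VecAll.All (a ≢_) w
  ∈-avoiding⁻ []      _  = VecAll.[]
  ∈-avoiding⁻ (b ∷ w) a∈ with a∈w , a≢b ← ∈-filter⁻ _ a∈ = a≢b VecAll.∷ ∈-avoiding⁻ w a∈w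

  length-avoiding : ∀ {m} (w : Vec (Fin k) m) → k ∸ m ≤ length (avoiding w)
  length-avoiding []              = ≤-reflexive (≡.sym (length-tabulate (λ i → i)))
  length-avoiding {suc m} (b ∷ w) = begin
    k ∸ suc m                            ≡⟨ pred[m∸n]≡m∸[1+n] k m ⟨
    pred (k ∸ m)                         ≤⟨ pred-mono-≤ (length-avoiding w) ⟩
    pred (length (avoiding w))           ≤⟨ pred-mono-≤ (length-without _≟_ b (avoiding-unique w)) ⟩
    length (without _≟_ b (avoiding w))  ∎
    where open ≤-Reasoning

module FreshSequences {k : ℕ} (s₀ : Fin k) where

  extensions : ∀ {m} → Vec (Fin k) m → List (Vec (Fin k) (suc m))
  extensions v = map (_∷ v) (avoiding (s₀ ∷ v))

  sequences : ∀ m → List (Vec (Fin k) m)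
  sequences zero    = [ [] ]
  sequences (suc m) = concatMap extensions (sequences m)

  sequences-fresh : ∀ m → All (λ v → Vec.Unique (s₀ ∷ v)) (sequences m)
  sequences-fresh zero    = (VecAll.[] Vec.∷ Vec.[]) ∷ []
  sequences-fresh (suc m) = Allₚ.concat⁺ (Allₚ.map⁺ (All.map extend (sequences-fresh m)))
    where
    extend : ∀ {v} → Vec.Unique (s₀ ∷ v) → All (λ u → Vec.Unique (s₀ ∷ u)) (extensions v)
    extend {v} (s₀∉v Vec.∷ v!) = Allₚ.map⁺ (All.tabulate λ a∈ → fresh (∈-avoiding⁻ (s₀ ∷ v) a∈))
      where
      fresh : ∀ {a} → VecAll.All (a ≢_) (s₀ ∷ v) → Vec.Unique (s₀ ∷ a ∷ v)
      fresh (a≢s₀ VecAll.∷ a∉v) = ((λ e → a≢s₀ (≡.sym e)) VecAll.∷ s₀∉v) Vec.∷ (a∉v Vec.∷ v!)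

  sequences-unique : ∀ m → Unique (sequences m)
  sequences-unique zero    = [] ∷ []
  sequences-unique (suc m) = Uniqueₚ.concat⁺
    (Allₚ.map⁺ (All.tabulate λ {v} _ → Uniqueₚ.map⁺ ∷-injectiveˡ (avoiding-unique (s₀ ∷ v))))
    (AllPairsₚ.map⁺ (AllPairs.map disjoint (sequences-unique m)))
    where
    disjoint : ∀ {v w} → v ≢ w → Disjoint (extensions v) (extensions w)
    disjoint v≢w (u∈v , u∈w) with _ , _ , refl ← ∈-map⁻ (_∷ _) u∈v | _ , _ , u≡ ← ∈-map⁻ (_∷ _) u∈w =
      v≢w (∷-injectiveʳ u≡)

  length-sequences : ∀ m → prodMinus k m ≤ length (sequences m)
  length-sequences zero    = ≤-refl
  length-sequences (suc m) = ≤-trans (*-monoˡ-≤ (k ∸ suc m) (length-sequences m))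
    (length-concatMap-≥ extensions extension-count (sequences m))
    where
    extension-count : ∀ v → k ∸ suc m ≤ length (extensions v)
    extension-count v =
      ≤-trans (length-avoiding (s₀ ∷ v)) (≤-reflexive (≡.sym (length-map (_∷ v) (avoiding (s₀ ∷ v)))))

module _ {d : ℕ} .{{_ : NonZero d}} where

  m%d≡n%d⇒[o+m]%d≡[o+n]%d : ∀ o {m n} → m % d ≡ n % d → (o + m) % d ≡ (o + n) % d
  m%d≡n%d⇒[o+m]%d≡[o+n]%d o {m} {n} e = begin
    (o + m) % d            ≡⟨ %-distribˡ-+ o m d ⟩
    (o % d + m % d) % d    ≡⟨ cong (λ x → (o % d + x) % d) e ⟩
    (o % d + n % d) % d    ≡⟨ %-distribˡ-+ o n d ⟨
    (o + n) % d            ∎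
    where open ≡-Reasoning

  [1+m]%d≡[1+n]%d⇒m%d≡n%d : ∀ {m n} → suc m % d ≡ suc n % d → m % d ≡ n % d
  [1+m]%d≡[1+n]%d⇒m%d≡n%d {m} {n} e = begin
    m % d                  ≡⟨ [m+n]%n≡m%n m d ⟨
    (m + d) % d            ≡⟨ cong (_% d) (+d≡pred[d]+suc m) ⟩
    (pred d + suc m) % d   ≡⟨ m%d≡n%d⇒[o+m]%d≡[o+n]%d (pred d) e ⟩
    (pred d + suc n) % d   ≡⟨ cong (_% d) (+d≡pred[d]+suc n) ⟨
    (n + d) % d            ≡⟨ [m+n]%n≡m%n n d ⟩
    n % d                  ∎
    where
    open ≡-Reasoning
    +d≡pred[d]+suc : ∀ m → m + d ≡ pred d + suc m
    +d≡pred[d]+suc m = trans (+-comm m d) (trans (cong (_+ m) (≡.sym (suc-pred d))) (≡.sym (+-suc (pred d) m)))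

  [1+m%d]%d≡[1+m]%d : ∀ m → suc (m % d) % d ≡ suc m % d
  [1+m%d]%d≡[1+m]%d m = m%d≡n%d⇒[o+m]%d≡[o+n]%d 1 (m%n%n≡m%n m d)

module _ {A : Set} {σ : A → A} (σ-injective : ∀ {a b} → σ a ≡ σ b → a ≡ b)
         (T : ℕ → A) {n : ℕ} (T-injective : ∀ {i j} → i < n → j < n → T i ≡ T j → i ≡ j) where

  private
    no-return : ∀ {j} → suc (suc j) < n → T j ≢ T (suc (suc j))
    no-return {j} lt e = <⇒≢ j<2+j (T-injective (<-trans j<2+j lt) lt e)
      where j<2+j = <-trans (n<1+n j) (n<1+n (suc j))

  -- Turning back would make T j ≡ T (j + 2).
  constant-orientation : 1 < n →
    (∀ {j} → suc j < n → T (suc j) ≡ σ (T j) ⊎ T j ≡ σ (T (suc j))) →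
    (∀ {j} → suc j < n → T (suc j) ≡ σ (T j)) ⊎ (∀ {j} → suc j < n → T j ≡ σ (T (suc j)))
  constant-orientation 1<n step with step 1<n
  ... | inj₁ fwd₀ = inj₁ forward
    where
    forward : ∀ {j} → suc j < n → T (suc j) ≡ σ (T j)
    forward {zero}  _  = fwd₀
    forward {suc j} lt with step lt
    ... | inj₁ fwd = fwd
    ... | inj₂ bwd = contradiction (σ-injective (trans (≡.sym (forward (<-trans (n<1+n _) lt))) bwd)) (no-return lt)
  ... | inj₂ bwd₀ = inj₂ backward
    where
    backward : ∀ {j} → suc j < n → T j ≡ σ (T (suc j))
    backward {zero}  _  = bwd₀
    backward {suc j} lt with step lt
    ... | inj₂ bwd = bwd
    ... | inj₁ fwd = contradiction (trans (backward (<-trans (n<1+n _) lt)) (≡.sym fwd)) (no-return lt)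

module CyclicOrder {A : Set} (_≟_ : DecidableEquality A) {r : ℕ} .{{_ : NonZero r}} (sv : Vec A r) where

  S : ℕ → A
  S m = lookup sv (m mod r)

  σ : A → A
  σ a with any? (λ i → lookup sv i ≟ a)
  ... | yes (i , _) = S (suc (toℕ i))
  ... | no  _       = a

  S-cong : ∀ {m n} → m % r ≡ n % r → S m ≡ S n
  S-cong {m} {n} e = cong (lookup sv) (fromℕ<-cong _ _ e (m%n<n m r) (m%n<n n r))

  S-toℕ : ∀ i → S (toℕ i) ≡ lookup sv i
  S-toℕ i = cong (lookup sv) (toℕ-injective (trans (toℕ-fromℕ< _) (m<n⇒m%n≡m (toℕ<n i))))

  S-periodic : S r ≡ S 0
  S-periodic = S-cong (trans (n%n≡0 r) (≡.sym (m<n⇒m%n≡m (>-nonZero⁻¹ r))))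

  module _ (sv! : Vec.Unique sv) where

    S-injective-mod : ∀ {m n} → S m ≡ S n → m % r ≡ n % r
    S-injective-mod {m} {n} e = begin
      m % r           ≡⟨ toℕ-fromℕ< _ ⟨
      toℕ (m mod r)   ≡⟨ cong toℕ (lookup-injective sv! _ _ e) ⟩
      toℕ (n mod r)   ≡⟨ toℕ-fromℕ< _ ⟩
      n % r           ∎
      where open ≡-Reasoning

    S-injective : ∀ {m n} → m < r → n < r → S m ≡ S n → m ≡ n
    S-injective {m} {n} m<r n<r e =
      trans (≡.sym (m<n⇒m%n≡m m<r)) (trans (S-injective-mod e) (m<n⇒m%n≡m n<r))

    σ-S : ∀ m → σ (S m) ≡ S (suc m)
    σ-S m with any? (λ i → lookup sv i ≟ S m)
    ... | yes (i , e) = S-cong (trans (cong (λ j → suc (toℕ j) % r) (lookup-injective sv! _ _ e))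
                                      (trans (cong (λ j → suc j % r) (toℕ-fromℕ< _)) ([1+m%d]%d≡[1+m]%d m)))
    ... | no  ∄i      = contradiction (m mod r , refl) ∄i

    σ-injective : ∀ {a b} → σ a ≡ σ b → a ≡ b
    σ-injective {a} {b} e with any? (λ i → lookup sv i ≟ a) | any? (λ i → lookup sv i ≟ b)
    ... | yes (i , refl) | yes (j , refl) =
      cong (lookup sv) (toℕ-injective (trans (≡.sym (m<n⇒m%n≡m (toℕ<n i)))
        (trans ([1+m]%d≡[1+n]%d⇒m%d≡n%d (S-injective-mod e)) (m<n⇒m%n≡m (toℕ<n j)))))
    ... | yes (i , _) | no  ∄j      = contradiction (_ mod r , e) ∄j
    ... | no  ∄i      | yes (j , _) = contradiction (_ mod r , ≡.sym e) ∄i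
    ... | no  _       | no  _       = e

    forwards-or-backwards : (T : ℕ → A) → T 0 ≡ S 0 → 1 < r →
      (∀ {i j} → i < r → j < r → T i ≡ T j → i ≡ j) →
      (∀ {j} → suc j < r → T (suc j) ≡ σ (T j) ⊎ T j ≡ σ (T (suc j))) →
      (∀ {i} → i < r → T i ≡ S i) ⊎ (∀ {i} → i < r → T i ≡ S (r ∸ i))
    forwards-or-backwards T T₀ 1<r T-injective step
      with constant-orientation σ-injective T T-injective 1<r step
    ... | inj₁ fwd = inj₁ forwards
      where
      forwards : ∀ {i} → i < r → T i ≡ S i
      forwards {zero}  _  = T₀
      forwards {suc i} lt = trans (fwd lt) (trans (cong σ (forwards (<-trans (n<1+n i) lt))) (σ-S i))
    ... | inj₂ bwd = inj₂ backwards
      where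
      backwards : ∀ {i} → i < r → T i ≡ S (r ∸ i)
      backwards {zero}  _  = trans T₀ (≡.sym S-periodic)
      backwards {suc i} lt = σ-injective (begin
        σ (T (suc i))         ≡⟨ bwd lt ⟨
        T i                   ≡⟨ backwards (<-trans (n<1+n i) lt) ⟩
        S (r ∸ i)             ≡⟨ cong S (+-∸-assoc 1 (<⇒≤ lt)) ⟩
        S (suc (r ∸ suc i))   ≡⟨ σ-S (r ∸ suc i) ⟨
        σ (S (r ∸ suc i))     ∎)
        where open ≡-Reasoning

-- Positions beyond steps carry no information.
record Walk {V : Set} (_⇒_ : V → V → Set) (u w : V) : Set where
  field
    steps : ℕ
    at    : ℕ → V
    start : at 0 ≡ u
    end   : at steps ≡ w
    arc   : ∀ {m} → m < steps → at m ⇒ at (suc m)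

open Walk

module _ {V : Set} {_⇒_ : V → V → Set} where

  fromStar : ∀ {u w} → Star _⇒_ u w → Walk _⇒_ u w
  fromStar {u} ε          = record { steps = 0 ; at = λ _ → u ; start = refl ; end = refl ; arc = λ () }
  fromStar {u} (u⇒v ◅ vw) = record
    { steps = suc (steps W)
    ; at    = λ { zero → u ; (suc m) → at W m }
    ; start = refl
    ; end   = end W
    ; arc   = λ { {zero} _ → subst (u ⇒_) (≡.sym (start W)) u⇒v ; {suc m} (s≤s m<) → arc W m< }
    }
    where W = fromStar vw

  fromStar-◅◅-nonempty : ∀ {u v w} → u ≢ v → (p : Star _⇒_ u v) (q : Star _⇒_ v w) →
    0 < steps (fromStar (p ◅◅ q))
  fromStar-◅◅-nonempty u≢v ε       _ = contradiction refl u≢v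
  fromStar-◅◅-nonempty _   (_ ◅ _) _ = s≤s z≤n

  -- Cut out the closed subwalk between the positions i < j of a repeated vertex.
  shortcut : ∀ {u w} (W : Walk _⇒_ u w) {i j} → i < j → j < steps W → at W i ≡ at W j →
    Σ (Walk _⇒_ u w) λ W′ → 0 < steps W′ × steps W′ < steps W
  shortcut {u} {w} W {i} {j} i<j j<L eq = W′ , ≤-trans (s≤s z≤n) i<L∸d , ∸-monoʳ-< (m<n⇒0<n∸m i<j) d≤L
    where
    L = steps W
    d = j ∸ i
    d≤L : d ≤ L
    d≤L = ≤-trans (m∸n≤m j i) (<⇒≤ j<L)
    i+d≡j : i + d ≡ j
    i+d≡j = m+[n∸m]≡n (<⇒≤ i<j)
    i<L∸d : i < L ∸ d
    i<L∸d = m+n≤o⇒m≤o∸n (suc i) (subst (_< L) (≡.sym i+d≡j) j<L)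

    at′ : ℕ → V
    at′ m with m ≤? i
    ... | yes _ = at W m
    ... | no  _ = at W (m + d)

    at′-≤ : ∀ {m} → m ≤ i → at′ m ≡ at W m
    at′-≤ {m} m≤i with m ≤? i
    ... | yes _   = refl
    ... | no  m≰i = contradiction m≤i m≰i

    at′-> : ∀ {m} → i < m → at′ m ≡ at W (m + d)
    at′-> {m} i<m with m ≤? i
    ... | yes m≤i = contradiction m≤i (<⇒≱ i<m)
    ... | no  _   = refl

    arc′ : ∀ {m} → m < L ∸ d → at′ m ⇒ at′ (suc m)
    arc′ {m} m< with <-cmp m i
    ... | tri< m<i _ _ =
      subst₂ _⇒_ (≡.sym (at′-≤ (<⇒≤ m<i))) (≡.sym (at′-≤ m<i)) (arc W (<-trans m<i (<-trans i<j j<L)))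
    ... | tri≈ _ refl _ =
      subst₂ _⇒_ (≡.sym (trans (at′-≤ ≤-refl) eq))
        (≡.sym (trans (at′-> (n<1+n i)) (cong (λ k → at W (suc k)) i+d≡j))) (arc W j<L)
    ... | tri> _ _ i<m =
      subst₂ _⇒_ (≡.sym (at′-> i<m)) (≡.sym (at′-> (<-trans i<m (n<1+n m))))
        (arc W (subst (m + d <_) (m∸n+n≡m d≤L) (+-monoˡ-< d m<)))

    W′ : Walk _⇒_ u w
    W′ = record
      { steps = L ∸ d
      ; at    = at′
      ; start = trans (at′-≤ z≤n) (start W)
      ; end   = trans (at′-> i<L∸d) (trans (cong (at W) (m∸n+n≡m d≤L)) (end W))
      ; arc   = arc′
      }

  -- The final position is excluded, so that closed walks can be simple.
  Simple : ∀ {u w} → Walk _⇒_ u w → Set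
  Simple W = Injective _≡_ _≡_ λ (i : Fin (steps W)) → at W (toℕ i)

  simplify : DecidableEquality V → ∀ {u w} (W : Walk _⇒_ u w) → 0 < steps W →
    Σ (Walk _⇒_ u w) λ W′ → 0 < steps W′ × Simple W′
  simplify _≟ᵥ_ W pos = go W pos (<-wellFounded (steps W))
    where
    go : ∀ {u w} (W : Walk _⇒_ u w) → 0 < steps W → Acc _<_ (steps W) →
      Σ (Walk _⇒_ u w) λ W′ → 0 < steps W′ × Simple W′
    go W pos (acc shorter) with any? (λ (i : Fin (steps W)) → any? λ (j : Fin (steps W)) →
                                    toℕ i <? toℕ j ×-dec at W (toℕ i) ≟ᵥ at W (toℕ j))
    ... | yes (i , j , i<j , eq) with W′ , pos′ , W′<W ← shortcut W i<j (toℕ<n j) eq = go W′ pos′ (shorter W′<W)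
    ... | no ∄repeat = W , pos , injective
      where
      injective : Simple W
      injective {i} {j} eq with <-cmp (toℕ i) (toℕ j)
      ... | tri< i<j _ _ = contradiction (i , j , i<j , eq) ∄repeat
      ... | tri≈ _ i≡j _ = toℕ-injective i≡j
      ... | tri> _ _ j<i = contradiction (j , i , j<i , ≡.sym eq) ∄repeat

Closed : ∀ {n} → (Fin n → Fin n → Set) → Subset n → Set
Closed _⇒_ R = ∀ {u w} → u ∈ R → u ⇒ w → w ∈ R

module _ {n : ℕ} {_⇒_ : Fin n → Fin n → Set} (_⇒?_ : Decidable _⇒_) where

  -- Grow the set of vertices reachable from z by one arc leaving it at a time.
  reachable-or-separated : ∀ z z′ → Star _⇒_ z z′ ⊎ ∃ λ R → z ∈ R × z′ ∉ R × Closed _⇒_ R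
  reachable-or-separated z z′ = grow (suc n) ⁅ z ⁆ (x∈⁅x⁆ z)
    (λ u∈⁅z⁆ → subst (Star _⇒_ z) (≡.sym (x∈⁅y⁆⇒x≡y z u∈⁅z⁆)) ε) (m≤m+n (suc n) _)
    where
    grow : ∀ fuel R → z ∈ R → (∀ {u} → u ∈ R → Star _⇒_ z u) → n < fuel + ∣ R ∣ →
      Star _⇒_ z z′ ⊎ ∃ λ R → z ∈ R × z′ ∉ R × Closed _⇒_ R
    grow fuel R z∈R reach bound with any? (λ u → any? λ w → u ∈? R ×-dec ¬? (w ∈? R) ×-dec u ⇒? w)
    ... | no ∄leaving with z′ ∈? R
    ...   | yes z′∈R = inj₁ (reach z′∈R)
    ...   | no  z′∉R = inj₂ (R , z∈R , z′∉R , closed)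
      where
      closed : Closed _⇒_ R
      closed {u} {w} u∈R u⇒w = decidable-stable (w ∈? R) λ w∉R → ∄leaving (u , w , u∈R , w∉R , u⇒w)
    grow zero R _ _ bound | yes _ = contradiction bound (≤⇒≯ (∣p∣≤n R))
    grow (suc fuel) R z∈R reach bound | yes (u , w , u∈R , w∉R , u⇒w) =
      grow fuel (R ∪ ⁅ w ⁆) (p⊆p∪q _ z∈R) reach′ (begin-strict
        n                       <⟨ bound ⟩
        suc fuel + ∣ R ∣        ≡⟨ +-suc fuel ∣ R ∣ ⟨
        fuel + suc ∣ R ∣        ≤⟨ +-monoʳ-≤ fuel ∣R∣<∣R∪w∣ ⟩
        fuel + ∣ R ∪ ⁅ w ⁆ ∣    ∎)
      where
      open ≤-Reasoning
      reach′ : ∀ {v} → v ∈ R ∪ ⁅ w ⁆ → Star _⇒_ z v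
      reach′ v∈ with x∈p∪q⁻ R ⁅ w ⁆ v∈
      ... | inj₁ v∈R = reach v∈R
      ... | inj₂ v∈w = subst (Star _⇒_ z) (≡.sym (x∈⁅y⁆⇒x≡y w v∈w)) (reach u∈R ◅◅ u⇒w ◅ ε)
      ∣R∣<∣R∪w∣ : ∣ R ∣ < ∣ R ∪ ⁅ w ⁆ ∣
      ∣R∣<∣R∪w∣ = p⊂q⇒∣p∣<∣q∣ (p⊆p∪q _ , w , x∈p∪q⁺ (inj₂ (x∈⁅x⁆ w)) , w∉R)

module _ {n : ℕ} {G : Graph n} {_⇒_ : Fin n → Fin n → Set} (⇒-adj : ∀ {u w} → u ⇒ w → Adj G u w)
         {x : Fin n} (W : Walk _⇒_ x x) (W! : Simple W) (3≤steps : 3 ≤ steps W) where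

  consecutive-arc : ∀ {i j : Fin (steps W)} → Consecutive i j → at W (toℕ i) ⇒ at W (toℕ j)
  consecutive-arc {i} (inj₁ i+1≡j) = subst (λ m → at W (toℕ i) ⇒ at W m) i+1≡j (arc W (toℕ<n i))
  consecutive-arc {i} {j} (inj₂ (i+1≡L , j≡0)) = subst (at W (toℕ i) ⇒_) closes (arc W (toℕ<n i))
    where
    closes : at W (suc (toℕ i)) ≡ at W (toℕ j)
    closes = trans (cong (at W) i+1≡L) (trans (end W) (trans (≡.sym (start W)) (cong (at W) (≡.sym j≡0))))

  walkCycle : Cycle G
  walkCycle = record
    { len      = steps W
    ; len≥3    = 3≤steps
    ; vert     = λ i → at W (toℕ i)
    ; distinct = W!
    ; adjacent = λ i j i→j → ⇒-adj (consecutive-arc i→j)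
    }

  walkCycle-contains : ContainsVertex walkCycle x
  walkCycle-contains = fromℕ< (≤-trans (s≤s z≤n) 3≤steps) , trans (cong (at W) (toℕ-fromℕ< _)) (start W)

  walkCycle-edge : ∀ {u w} → CycleEdge walkCycle u w → u ⇒ w ⊎ w ⇒ u
  walkCycle-edge (i , j , i→j , inj₁ (refl , refl)) = inj₁ (consecutive-arc i→j)
  walkCycle-edge (i , j , i→j , inj₂ (refl , refl)) = inj₂ (consecutive-arc i→j)

Proper : ∀ {n k} → Graph n → (Fin n → Fin k) → Set
Proper G c = ∀ u v → Adj G u v → c u ≢ c v

Adj-sym : ∀ {n} (G : Graph n) {u v} → Adj G u v → Adj G v u
Adj-sym G {u} {v} = subst T (Graph.sym G u v)

Endpoints : ∀ {n} → Fin n → Fin n → Fin n → Fin n → Set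
Endpoints a b u v = (u ≡ a × v ≡ b) ⊎ (u ≡ b × v ≡ a)

Endpoints-sym : ∀ {n} {a b u v : Fin n} → Endpoints a b u v → Endpoints a b v u
Endpoints-sym (inj₁ (u≡a , v≡b)) = inj₂ (v≡b , u≡a)
Endpoints-sym (inj₂ (u≡b , v≡a)) = inj₁ (v≡a , u≡b)

Endpoints-≢ : ∀ {n} {a b u v : Fin n} → a ≢ b → Endpoints a b u v → u ≢ v
Endpoints-≢ a≢b (inj₁ (refl , refl)) = a≢b
Endpoints-≢ a≢b (inj₂ (refl , refl)) = λ b≡a → a≢b (≡.sym b≡a)

other-endpoint : ∀ {n} {a b x : Fin n} → x ≡ a ⊎ x ≡ b → ∃ (Endpoints a b x)
other-endpoint {b = b} (inj₁ x≡a) = b , inj₁ (x≡a , refl)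
other-endpoint {a = a} (inj₂ x≡b) = a , inj₂ (x≡b , refl)

isEdge-endpoints : ∀ {n} {a b u v : Fin n} → T (isEdge a b u v) → Endpoints a b u v
isEdge-endpoints {a = a} {b} {u} {v} t =
  Sum.map witnesses witnesses (Equivalence.to (T-∨ {⌊ u ≟ a ⌋ ∧ ⌊ v ≟ b ⌋}) t)
  where
  witnesses : ∀ {p q r s : Fin _} → T (⌊ p ≟ q ⌋ ∧ ⌊ r ≟ s ⌋) → p ≡ q × r ≡ s
  witnesses {p} {q} {r} {s} t with t₁ , t₂ ← Equivalence.to (T-∧ {⌊ p ≟ q ⌋}) t =
    toWitness {a? = p ≟ q} t₁ , toWitness {a? = r ≟ s} t₂

deleteEdge-proper⇒proper : ∀ {n k} (G : Graph n) (a b : Fin n) {c : Fin n → Fin k} →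
  Proper (deleteEdge G a b) c → c a ≢ c b → Proper G c
deleteEdge-proper⇒proper G a b c-proper ca≢cb u v uv with isEdge a b u v in e
... | false = c-proper u v (Equivalence.from T-∧ (uv , subst (λ t → T (not t)) (≡.sym e) tt))
... | true with isEdge-endpoints {a = a} {b} {u} {v} (subst T (≡.sym e) tt)
...   | inj₁ (refl , refl) = ca≢cb
...   | inj₂ (refl , refl) = λ cb≡ca → ca≢cb (≡.sym cb≡ca)

module _ {n k} (H : Graph n) (c : Fin n → Fin k) (σ : Fin k → Fin k) where

  Arc : Fin n → Fin n → Set
  Arc u w = Adj H u w × c w ≡ σ (c u)

  arc? : Decidable Arc
  arc? u w = T? (adj H u w) ×-dec (c w ≟ σ (c u))

  shift : Subset n → Fin n → Fin k
  shift R w with w ∈? R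
  ... | yes _ = σ (c w)
  ... | no  _ = c w

  shift-∈ : ∀ {R w} → w ∈ R → shift R w ≡ σ (c w)
  shift-∈ {R} {w} w∈R with w ∈? R
  ... | yes _   = refl
  ... | no  w∉R = contradiction w∈R w∉R

  shift-∉ : ∀ {R w} → w ∉ R → shift R w ≡ c w
  shift-∉ {R} {w} w∉R with w ∈? R
  ... | yes w∈R = contradiction w∈R w∉R
  ... | no  _   = refl

  shift-proper : (∀ {i j} → σ i ≡ σ j → i ≡ j) → Proper H c → ∀ {R} → Closed Arc R → Proper H (shift R)
  shift-proper σ-injective c-proper {R} closed u w uw with u ∈? R | w ∈? R
  ... | yes _   | yes _   = λ σcu≡σcw → c-proper u w uw (σ-injective σcu≡σcw)
  ... | yes u∈R | no  w∉R = λ σcu≡cw → w∉R (closed u∈R (uw , ≡.sym σcu≡cw))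
  ... | no  u∉R | yes w∈R = λ cu≡σcw → u∉R (closed w∈R (Adj-sym H uw , cu≡σcw))
  ... | no  _   | no  _   = c-proper u w uw

module Critical {n k} (G : Graph n) (a b : Fin n) (ab : Adj G a b) (G-not-k : ¬ Colourable G k)
                {c : Fin n → Fin k} (c-proper : Proper (deleteEdge G a b) c) where

  H : Graph n
  H = deleteEdge G a b

  a≢b : a ≢ b
  a≢b refl = subst T (irrefl G a) ab

  ends-same-colour : c a ≡ c b
  ends-same-colour with c a ≟ c b
  ... | yes ca≡cb = ca≡cb
  ... | no  ca≢cb = contradiction (c , deleteEdge-proper⇒proper G a b c-proper ca≢cb) G-not-k

  endpoint-colours : ∀ {u v} → Endpoints a b u v → c u ≡ c a × c v ≡ c a
  endpoint-colours (inj₁ (refl , refl)) = refl , ≡.sym ends-same-colour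
  endpoint-colours (inj₂ (refl , refl)) = ≡.sym ends-same-colour , refl

  -- Otherwise shifting the colours of a closed set separating a from b along σ would colour G.
  connected : ∀ {σ} → (∀ {i j} → σ i ≡ σ j → i ≡ j) → σ (c a) ≢ c a →
    ∀ {z z′} → Endpoints a b z z′ → Star (Arc H c σ) z z′
  connected {σ} σ-injective σ-moves {z} {z′} zz′ with reachable-or-separated (arc? H c σ) z z′
  ... | inj₁ path = path
  ... | inj₂ (R , z∈R , z′∉R , closed) = contradiction (shift H c σ R , G-proper) G-not-k
    where
    separated : shift H c σ R z ≢ shift H c σ R z′
    separated e = σ-moves (begin
      σ (c a)            ≡⟨ cong σ (proj₁ (endpoint-colours zz′)) ⟨
      σ (c z)            ≡⟨ shift-∈ H c σ z∈R ⟨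
      shift H c σ R z    ≡⟨ e ⟩
      shift H c σ R z′   ≡⟨ shift-∉ H c σ z′∉R ⟩
      c z′               ≡⟨ proj₂ (endpoint-colours zz′) ⟩
      c a                ∎)
      where open ≡-Reasoning
    separated-ab : Endpoints a b z z′ → shift H c σ R a ≢ shift H c σ R b
    separated-ab (inj₁ (refl , refl)) = separated
    separated-ab (inj₂ (refl , refl)) = λ e → separated (≡.sym e)
    G-proper : Proper G (shift H c σ R)
    G-proper = deleteEdge-proper⇒proper G a b
      (shift-proper H c σ σ-injective c-proper closed) (separated-ab zz′)

  module _ {r′ : ℕ} (2≤r′ : 2 ≤ r′) {x y : Fin n} (xy : Endpoints a b x y) where

    private
      1<r : 1 < suc r′
      1<r = s≤s (≤-trans (s≤s z≤n) 2≤r′)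

    module SequenceCycle (v : Vec (Fin k) r′) (v! : Vec.Unique (c x ∷ v)) where
      open CyclicOrder _≟_ (c x ∷ v) public

      σ-moves : σ (c a) ≢ c a
      σ-moves σca≡ca = contradiction (S-injective v! 1<r (s≤s z≤n) (begin
        S 1        ≡⟨ σ-S v! 0 ⟨
        σ (c x)    ≡⟨ cong σ cx≡ca ⟩
        σ (c a)    ≡⟨ σca≡ca ⟩
        c a        ≡⟨ cx≡ca ⟨
        c x        ∎)) λ ()
        where
        open ≡-Reasoning
        cx≡ca = proj₁ (endpoint-colours xy)

      simpleWalk : Σ (Walk (Arc H c σ) x x) λ W → 0 < steps W × Simple W
      simpleWalk = simplify _≟_ (fromStar (x⇒y ◅◅ y⇒x)) (fromStar-◅◅-nonempty (Endpoints-≢ a≢b xy) x⇒y y⇒x)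
        where
        x⇒y = connected (σ-injective v!) σ-moves xy
        y⇒x = connected (σ-injective v!) σ-moves (Endpoints-sym xy)

      W : Walk (Arc H c σ) x x
      W = proj₁ simpleWalk

      W-simple : Simple W
      W-simple = proj₂ (proj₂ simpleWalk)

      walk-colours : ∀ {u} (W : Walk (Arc H c σ) x u) {m} → m ≤ steps W → c (at W m) ≡ S m
      walk-colours W {zero}  _  = cong c (start W)
      walk-colours W {suc m} m< = trans (proj₂ (arc W m<)) (trans (cong σ (walk-colours W (<⇒≤ m<))) (σ-S v! m))

      r∣steps : suc r′ ∣ steps W
      r∣steps = m%n≡0⇒n∣m (steps W) (suc r′) (S-injective-mod v! {steps W} {0} (begin
        S (steps W)          ≡⟨ walk-colours W ≤-refl ⟨
        c (at W (steps W))   ≡⟨ cong c (end W) ⟩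
        c x                  ∎))
        where open ≡-Reasoning

      r≤steps : suc r′ ≤ steps W
      r≤steps = ∣⇒≤ {{>-nonZero (proj₁ (proj₂ simpleWalk))}} r∣steps

      3≤steps : 3 ≤ steps W
      3≤steps = ≤-trans (s≤s 2≤r′) r≤steps

      cycle : Cycle H
      cycle = walkCycle proj₁ W W-simple 3≤steps

      cycle-contains : ContainsVertex cycle x
      cycle-contains = walkCycle-contains {G = H} proj₁ W W-simple 3≤steps

      cycle-colours : ∀ i → c (vert cycle i) ≡ S (toℕ i)
      cycle-colours i = walk-colours W (<⇒≤ (toℕ<n i))

      cycle-edge : ∀ {u w p q} → CycleEdge cycle u w → c u ≡ p → c w ≡ q → q ≡ σ p ⊎ p ≡ σ q
      cycle-edge e refl refl = Sum.map proj₂ proj₂ (walkCycle-edge {G = H} proj₁ W W-simple 3≤steps e)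

      consecutive-colours : ∀ {j} → suc j < suc r′ →
        ∃₂ λ u w → CycleEdge cycle u w × c u ≡ S j × c w ≡ S (suc j)
      consecutive-colours {j} lt =
        vert cycle i , vert cycle i′ , (i , i′ , inj₁ i→i′ , inj₁ (refl , refl)) ,
        trans (cycle-colours i) (cong S (toℕ-fromℕ< j<L)) , trans (cycle-colours i′) (cong S (toℕ-fromℕ< j+1<L))
        where
        j+1<L = ≤-trans lt r≤steps
        j<L   = <-trans (n<1+n j) j+1<L
        i     = fromℕ< j<L
        i′    = fromℕ< j+1<L
        i→i′ : suc (toℕ i) ≡ toℕ i′
        i→i′ = trans (cong suc (toℕ-fromℕ< j<L)) (≡.sym (toℕ-fromℕ< j+1<L))

    -- Entry i of v is term i + 1 of the cyclic sequence c x ∷ v, so read backwards it is term r′ − i.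
    reversed : Vec (Fin k) r′ → Vec (Fin k) r′
    reversed v = tabulate λ i → CyclicOrder.S _≟_ (c x ∷ v) (r′ ∸ toℕ i)

    -- The colours along the cycle of t step through the sequence of s, in one direction or the other.
    same-cycle⇒same-or-reversed : ∀ {s t} (s! : Vec.Unique (c x ∷ s)) (t! : Vec.Unique (c x ∷ t)) →
      SameCycle (SequenceCycle.cycle s s!) (SequenceCycle.cycle t t!) → t ≡ s ⊎ t ≡ reversed s
    same-cycle⇒same-or-reversed {s} {t} s! t! same =
      Sum.map forwards backwards (Sₛ.forwards-or-backwards s! Sₜ.S refl 1<r (Sₜ.S-injective t!) step)
      where
      module Sₛ = SequenceCycle s s!
      module Sₜ = SequenceCycle t t!

      step : ∀ {j} → suc j < suc r′ → Sₜ.S (suc j) ≡ Sₛ.σ (Sₜ.S j) ⊎ Sₜ.S j ≡ Sₛ.σ (Sₜ.S (suc j))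
      step lt = let u , w , uw , cu , cw = Sₜ.consecutive-colours lt in
        Sₛ.cycle-edge (proj₂ (same u w) uw) cu cw

      forwards : (∀ {i} → i < suc r′ → Sₜ.S i ≡ Sₛ.S i) → t ≡ s
      forwards h = Pointwise-≡⇒≡ (ext λ i →
        trans (≡.sym (Sₜ.S-toℕ (Fin.suc i))) (trans (h (s≤s (toℕ<n i))) (Sₛ.S-toℕ (Fin.suc i))))

      backwards : (∀ {i} → i < suc r′ → Sₜ.S i ≡ Sₛ.S (suc r′ ∸ i)) → t ≡ reversed s
      backwards h = Pointwise-≡⇒≡ (ext λ i →
        trans (≡.sym (Sₜ.S-toℕ (Fin.suc i))) (trans (h (s≤s (toℕ<n i))) (≡.sym (lookup∘tabulate _ i))))

    open FreshSequences (c x)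

    cycles-through : ∃ λ (cs : List (Cycle H)) →
      All (λ C → suc r′ ∣ len C × ContainsVertex C x) cs ×
      AllPairs (λ C D → ¬ SameCycle C D) cs ×
      prodMinus k r′ ≤ 2 * length cs
    cycles-through
      with ys , ys⊆ , ys-apart , halved ← halving (≡-dec _≟_) reversed (sequences r′) (sequences-unique r′) =
      All.reduce cycleOf ys! ,
      reduce⁺ cycleOf (λ {v} v! → SequenceCycle.r∣steps v v! , SequenceCycle.cycle-contains v v!) ys! ,
      reduce-pairs⁺ cycleOf distinct-cycles ys! ys-apart ,
      (begin
        prodMinus k r′                   ≤⟨ length-sequences r′ ⟩
        length (sequences r′)            ≤⟨ halved ⟩
        2 * length ys                    ≡⟨ cong (2 *_) (length-reduce cycleOf ys!) ⟨
        2 * length (All.reduce cycleOf ys!) ∎)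
      where
      open ≤-Reasoning
      cycleOf : ∀ {v} → Vec.Unique (c x ∷ v) → Cycle H
      cycleOf {v} v! = SequenceCycle.cycle v v!
      ys! = Allₚ.anti-mono ys⊆ (sequences-fresh r′)
      distinct-cycles : ∀ {s t} (s! : Vec.Unique (c x ∷ s)) (t! : Vec.Unique (c x ∷ t)) →
        s ≢ t × t ≢ reversed s → ¬ SameCycle (cycleOf s!) (cycleOf t!)
      distinct-cycles s! t! (s≢t , t≢s′) same =
        [ (λ t≡s → s≢t (≡.sym t≡s)) , t≢s′ ]′ (same-cycle⇒same-or-reversed s! t! same)

theorem4 : (r k : ℕ) → 3 ≤ r → r ≤ k →
    (n : ℕ) (G : Graph n) (a b : Fin n) → Adj G a b →
    ChromaticNumber G (suc k) → ChromaticNumber (deleteEdge G a b) k →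
    (x : Fin n) → x ≡ a ⊎ x ≡ b →
    ∃ λ (cs : List (Cycle (deleteEdge G a b))) →
    All (λ C → r ∣ len C × ContainsVertex C x) cs ×
    AllPairs (λ C D → ¬ SameCycle C D) cs ×
    prodMinus k (r ∸ 1) ≤ 2 * length cs
theorem4 (suc r′) k 3≤r _ n G a b ab (_ , G-not-below) ((c , c-proper) , _) x x∈ab =
  Critical.cycles-through G a b ab (G-not-below k (n<1+n k)) c-proper (s≤s⁻¹ 3≤r) (proj₂ (other-endpoint x∈ab))
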